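{- Let $K,P$ be positive integers with $2K\le P$, let $n\ge2$ and $\theta=(K,P)$. For each $r=2,\dots,n$, $$\mathbb{P}\big[C_r(\theta)\big]\le r^{r-2}\big(1-q(\theta)\big)^{r-1},$$ where $C_r(\theta)$ is the event that the subgraph of $\mathbb{K}(n;\theta)$ induced on $\{1,\dots,r\}$ is connected.
   Context: The random key graph $\mathbb{K}(n;\theta)$ on vertex set $\{1,\dots,n\}$ is constructed as follows. Let $K_1(\theta),\dots,K_n(\theta)$ be i.i.d. random sets, each uniformly distributed over the $K$-element subsets of $\{1,\dots,P\}$. Distinct nodes $i,j$ are adjacent iff $K_i(\theta)\cap K_j(\theta)\ne\emptyset$. Here $q(\theta)=\binom{P-K}{K}\big/\binom{P}{K}$. -}

module Defs where

open import Data.Nat as ℕ using (ℕ; zero; suc; _≤_; _∸_)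
open import Data.Nat.Combinatorics using (_C_)
open import Data.Integer using (+_)
open import Data.Rational using (ℚ; 0ℚ; 1ℚ; _*_; _-_; _/_)
open import Data.Fin using (Fin; inject≤)
open import Data.Fin.Subset using (Subset; ∣_∣; _∩_; Nonempty)
open import Data.Vec using (Vec; lookup)
open import Data.List using (List; length; filter)
open import Data.Product using (Σ; _×_; proj₁)
open import Relation.Nullary using (¬_)
open import Relation.Unary using (Pred; Decidable)
open import Relation.Binary.PropositionalEquality using (_≡_; _≢_)
open import Relation.Binary.Construct.Closure.ReflexiveTransitive using (Star)
open import Data.List.Relation.Unary.Unique.Propositional using (Unique)
open import Data.List.Membership.Propositional using (_∈_)
open import Level using (0ℓ)

-- Natural-number fraction as a rational; a / 0 := 0 (never used: denominators are positive).
frac : ℕ → ℕ → ℚ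
frac a zero    = 0ℚ
frac a (suc d) = (+ a) / suc d

_^ℚ_ : ℚ → ℕ → ℚ
x ^ℚ zero  = 1ℚ
x ^ℚ suc k = x * (x ^ℚ k)

-- A K-element subset of {1,...,P} (represented as Fin P).
KeyRing : ℕ → ℕ → Set
KeyRing K P = Σ (Subset P) (λ s → ∣ s ∣ ≡ K)

-- An outcome of the random key graph K(n; (K,P)): the key rings of the n nodes.
Outcome : ℕ → ℕ → ℕ → Set
Outcome n K P = Vec (KeyRing K P) n

q : ℕ → ℕ → ℚ
q K P = frac ((P ∸ K) C K) (P C K)

Adj : ∀ {n K P} → Outcome n K P → Fin n → Fin n → Set
Adj ω i j = i ≢ j × Nonempty (proj₁ (lookup ω i) ∩ proj₁ (lookup ω j))


InducedConnected : ∀ {n K P} (r : ℕ) → r ≤ n → Outcome n K P → Set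
InducedConnected r r≤n ω =
  ∀ (i j : Fin r) → Star (λ a b → Adj ω (inject≤ a r≤n) (inject≤ b r≤n)) i j

-- Probability of an event E under the uniform distribution on a finite sample space,
-- given a duplicate-free complete enumeration of the space and a decision procedure for E.
Prob : {Ω : Set} (xs : List Ω) {E : Pred Ω 0ℓ} → Decidable E → ℚ
Prob xs dec = frac (length (filter dec xs)) (length xs)

Enumerates : {Ω : Set} → List Ω → Set
Enumerates {Ω} xs = Unique xs × (∀ (ω : Ω) → ω ∈ xs)

module Submission where

-- Let M = C(P,K) be the number of key rings and I = M - C(P-K,K) the number
-- of key rings meeting a fixed one, so that 1 - q = I/M.  Fix the key ring of
-- node 1 and view the key rings of nodes 2..r as a word of length m = r-1.
-- If the graph induced on {1..r} is connected, breadth-first search from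
-- node 1 reaches every node: the word is exhausted by successive layers, each
-- consisting of the not yet reached nodes adjacent to the previous layer.
-- Counting words layer by layer -- a node adjacent to a layer of size c has
-- at most c·I key rings to choose from -- bounds the number of such words by
-- the recursion `layerBound`, which an Abel-type identity evaluates to
-- c (c+m)^(m-1) I^m, the number of rooted forests times I^m; for c = 1 this
-- is r^(r-2) I^(r-1).  Summing over node 1 and over nodes r+1..n and dividing
-- by M^n gives P[C_r] ≤ r^(r-2) (I/M)^(r-1).

open import Defs
open import Level using (0ℓ)
open import Function using (_∘_)
open import Function.Bundles using (Equivalence)
open import Data.Empty using (⊥; ⊥-elim)
open import Data.Bool using (Bool; true; false; not; _∧_; _∨_; T)
open import Data.Bool.Properties using (∧-comm; ∧-zeroʳ; T-∨; T-≡)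
open import Data.Nat using (ℕ; zero; suc; _+_; _*_; _∸_; _^_; _≤_; z≤n; s≤s; >-nonZero)
open import Data.Nat.Properties
open import Algebra.Properties.CommutativeSemigroup +-commutativeSemigroup using (interchange)
open import Data.Nat.Combinatorics using (_C_; nCk+nC[k+1]≡[n+1]C[k+1])
open import Data.Nat.Tactic.RingSolver using (solve-∀)
import Data.Integer as ℤ
import Data.Integer.Properties as ℤP
import Data.Integer.Tactic.RingSolver as ℤSolver
open import Data.Rational using (1ℚ; _-_; toℚᵘ)
import Data.Rational as Q
import Data.Rational.Properties as ℚP
open import Data.Rational.Properties using (toℚᵘ-cancel-≤; toℚᵘ-fromℚᵘ; toℚᵘ-injective; toℚᵘ-homo-*; toℚᵘ-homo-+; toℚᵘ-homo‿-)
open import Data.Rational.Unnormalised as ℚᵘ using (mkℚᵘ; *≤*; *≡*)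
import Data.Rational.Unnormalised.Properties as ℚᵘP
open import Data.Product using (∃; _×_; _,_; proj₁; proj₂)
open import Data.Sum using (inj₁; inj₂)
open import Data.List using (List; []; _∷_; length; _++_; map; filter; cartesianProductWith)
open import Data.Bool.ListAction using (any)
open import Data.List.Properties using (length-++; length-map; length-++-sucʳ)
open import Data.List.Membership.Propositional using (_∈_; lose)
open import Data.List.Membership.Propositional.Properties using (∈-map⁺; ∈-map⁻; ∈-++⁺ˡ; ∈-++⁺ʳ; ∈-cartesianProductWith⁺; ∈-filter⁺; ∈-filter⁻; ∈-∃++; ∈-length)
open import Data.List.Relation.Unary.Any using (here; there)
open import Data.List.Relation.Unary.Any.Properties using (any⁺)
open import Data.List.Relation.Unary.All as All using ([])
open import Data.List.Relation.Unary.AllPairs using ([]; _∷_)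
open import Data.List.Relation.Unary.Unique.Propositional using (Unique)
import Data.List.Relation.Unary.Unique.Propositional.Properties as Uniqueₚ
open import Data.Vec using (Vec; []; _∷_; lookup; head)
open import Data.Vec.Properties using (∷-injective; []=⇒lookup; lookup-zipWith)
open import Data.Fin using (Fin; zero; suc; inject≤)
open import Data.Fin.Subset using (Subset; ∣_∣; _∩_; Nonempty)
open import Data.Fin.Subset.Properties using (∣p∣≤n)
open import Relation.Binary.PropositionalEquality
open import Relation.Binary.Construct.Closure.ReflexiveTransitive using (Star; ε; _◅_)
open import Relation.Nullary using (¬_; yes; no; does)
open import Relation.Nullary.Decidable using (T?)
open import Relation.Unary using (Pred; Decidable)
open import Relation.Unary.Properties using (∁?)

𝟙 : Bool → ℕ
𝟙 true  = 1
𝟙 false = 0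

𝟙-∨ : ∀ a b → 𝟙 (a ∨ b) ≤ 𝟙 a + 𝟙 b
𝟙-∨ true  b = s≤s z≤n
𝟙-∨ false b = ≤-refl

∑ : {B : Set} → List B → (B → ℕ) → ℕ
∑ []       f = 0
∑ (x ∷ xs) f = f x + ∑ xs f

module _ {B : Set} where

  ∑-mono : ∀ (xs : List B) {f g : B → ℕ} → (∀ x → f x ≤ g x) → ∑ xs f ≤ ∑ xs g
  ∑-mono []       f≤g = z≤n
  ∑-mono (x ∷ xs) f≤g = +-mono-≤ (f≤g x) (∑-mono xs f≤g)

  ∑-cong : ∀ (xs : List B) {f g : B → ℕ} → (∀ x → f x ≡ g x) → ∑ xs f ≡ ∑ xs g
  ∑-cong []       f≡g = refl
  ∑-cong (x ∷ xs) f≡g = cong₂ _+_ (f≡g x) (∑-cong xs f≡g)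

  ∑-zero : ∀ (xs : List B) → ∑ xs (λ _ → 0) ≡ 0
  ∑-zero []       = refl
  ∑-zero (x ∷ xs) = ∑-zero xs

  ∑-const : ∀ (xs : List B) c → ∑ xs (λ _ → c) ≡ length xs * c
  ∑-const []       c = refl
  ∑-const (x ∷ xs) c = cong (c +_) (∑-const xs c)

  ∑-+ : ∀ (xs : List B) (f g : B → ℕ) → ∑ xs (λ x → f x + g x) ≡ ∑ xs f + ∑ xs g
  ∑-+ []       f g = refl
  ∑-+ (x ∷ xs) f g =
    trans (cong (f x + g x +_) (∑-+ xs f g)) (interchange (f x) (g x) (∑ xs f) (∑ xs g))

  ∑-*ˡ : ∀ (xs : List B) c (f : B → ℕ) → ∑ xs (λ x → c * f x) ≡ c * ∑ xs f
  ∑-*ˡ []       c f = sym (*-zeroʳ c)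
  ∑-*ˡ (x ∷ xs) c f =
    trans (cong (c * f x +_) (∑-*ˡ xs c f)) (sym (*-distribˡ-+ c (f x) (∑ xs f)))

  ∑-*ʳ : ∀ (xs : List B) c (f : B → ℕ) → ∑ xs (λ x → f x * c) ≡ ∑ xs f * c
  ∑-*ʳ xs c f = trans (∑-cong xs (λ x → *-comm (f x) c)) (trans (∑-*ˡ xs c f) (*-comm c _))

  ∑-++ : ∀ (xs ys : List B) (f : B → ℕ) → ∑ (xs ++ ys) f ≡ ∑ xs f + ∑ ys f
  ∑-++ []       ys f = refl
  ∑-++ (x ∷ xs) ys f = trans (cong (f x +_) (∑-++ xs ys f)) (sym (+-assoc (f x) _ _))

  ∑-𝟙-split : ∀ (xs : List B) (g : B → Bool) →
              ∑ xs (λ x → 𝟙 (g x)) + ∑ xs (λ x → 𝟙 (not (g x))) ≡ length xs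
  ∑-𝟙-split []       g = refl
  ∑-𝟙-split (x ∷ xs) g with g x
  ... | true  = cong suc (∑-𝟙-split xs g)
  ... | false = trans (+-suc _ _) (cong suc (∑-𝟙-split xs g))

  filter-partition : ∀ {P : Pred B 0ℓ} (P? : Decidable P) (xs : List B) →
                     length (filter P? xs) + length (filter (∁? P?) xs) ≡ length xs
  filter-partition P? []       = refl
  filter-partition P? (x ∷ xs) with does (P? x)
  ... | true  = cong suc (filter-partition P? xs)
  ... | false = trans (+-suc _ _) (cong suc (filter-partition P? xs))

  length-filter≤∑ : ∀ {P : Pred B 0ℓ} (P? : Decidable P) (xs : List B) (g : B → ℕ) →
                    (∀ x → P x → 1 ≤ g x) → length (filter P? xs) ≤ ∑ xs g
  length-filter≤∑ P? []       g P⇒1≤g = z≤n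
  length-filter≤∑ P? (x ∷ xs) g P⇒1≤g with P? x
  ... | yes px = +-mono-≤ (P⇒1≤g x px) (length-filter≤∑ P? xs g P⇒1≤g)
  ... | no  _  = ≤-trans (length-filter≤∑ P? xs g P⇒1≤g) (m≤n+m _ _)

∑-swap : ∀ {B C : Set} (xs : List B) (ys : List C) (f : B → C → ℕ) →
         ∑ xs (λ x → ∑ ys (f x)) ≡ ∑ ys (λ y → ∑ xs (λ x → f x y))
∑-swap []       ys f = sym (∑-zero ys)
∑-swap (x ∷ xs) ys f =
  trans (cong (∑ ys (f x) +_) (∑-swap xs ys f)) (sym (∑-+ ys (f x) (λ y → ∑ xs (λ x′ → f x′ y))))

∑-map : ∀ {B C : Set} (g : B → C) (xs : List B) (f : C → ℕ) → ∑ (map g xs) f ≡ ∑ xs (f ∘ g)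
∑-map g []       f = refl
∑-map g (x ∷ xs) f = cong (f (g x) +_) (∑-map g xs f)

∑-cartesian : ∀ {A B C : Set} (g : A → B → C) (xs : List A) (ys : List B) (f : C → ℕ) →
              ∑ (cartesianProductWith g xs ys) f ≡ ∑ xs (λ x → ∑ ys (λ y → f (g x y)))
∑-cartesian g []       ys f = refl
∑-cartesian g (x ∷ xs) ys f =
  trans (∑-++ (map (g x) ys) _ f) (cong₂ _+_ (∑-map (g x) ys f) (∑-cartesian g xs ys f))

length-cartesian : ∀ {A B C : Set} (g : A → B → C) (xs : List A) (ys : List B) →
                   length (cartesianProductWith g xs ys) ≡ length xs * length ys
length-cartesian g []       ys = refl
length-cartesian g (x ∷ xs) ys =
  trans (length-++ (map (g x) ys)) (cong₂ _+_ (length-map (g x) ys) (length-cartesian g xs ys))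

unique-length-≤ : ∀ {B : Set} {xs ys : List B} → Unique xs → (∀ {x} → x ∈ xs → x ∈ ys) →
                  length xs ≤ length ys
unique-length-≤ {xs = []}     _          _    = z≤n
unique-length-≤ {xs = x ∷ xs} (x∉ ∷ uxs) xs⊆ys with ∈-∃++ (xs⊆ys (here refl))
... | as , bs , refl =
  ≤-trans (s≤s (unique-length-≤ uxs (λ z∈ → remove as (xs⊆ys (there z∈)) (x≢ z∈))))
          (≤-reflexive (sym (length-++-sucʳ as x bs)))
  where
  x≢ : ∀ {z} → z ∈ xs → z ≢ x
  x≢ z∈ z≡x = All.lookup x∉ z∈ (sym z≡x)
  remove : ∀ {z} as {bs} → z ∈ as ++ x ∷ bs → z ≢ x → z ∈ as ++ bs
  remove []       (here z≡x) z≢x = ⊥-elim (z≢x z≡x)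
  remove []       (there z∈) z≢x = z∈
  remove (a ∷ as) (here z≡a) z≢x = here z≡a
  remove (a ∷ as) (there z∈) z≢x = there (remove as z∈ z≢x)

-- The bound produced by splitting words into layers: starting from h, each
-- further letter either joins the current layer (at most c choices, a grows)
-- or is deferred to later layers (b grows).
layerBound : (c : ℕ) (h : ℕ → ℕ → ℕ) (a b m : ℕ) → ℕ
layerBound c h a b zero    = h a b
layerBound c h a b (suc m) = c * layerBound c h (suc a) b m + layerBound c h a (suc b) m

module Words {A : Set} (X : List A) where

  ∑ʷ : ℕ → (List A → ℕ) → ℕ
  ∑ʷ zero    f = f []
  ∑ʷ (suc m) f = ∑ X (λ x → ∑ʷ m (λ zs → f (x ∷ zs)))

  ∑ʷ-zero : ∀ m → ∑ʷ m (λ _ → 0) ≡ 0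
  ∑ʷ-zero zero    = refl
  ∑ʷ-zero (suc m) = trans (∑-cong X (λ x → ∑ʷ-zero m)) (∑-zero X)

  ∑ʷ-swap : ∀ {C : Set} (ys : List C) m (g : C → List A → ℕ) →
            ∑ʷ m (λ zs → ∑ ys (λ y → g y zs)) ≡ ∑ ys (λ y → ∑ʷ m (g y))
  ∑ʷ-swap ys zero    g = refl
  ∑ʷ-swap ys (suc m) g =
    trans (∑-cong X (λ x → ∑ʷ-swap ys m (λ y zs → g y (x ∷ zs))))
          (∑-swap X ys (λ x y → ∑ʷ m (λ zs → g y (x ∷ zs))))

  module LayerSplit {P : Pred A 0ℓ} (P? : Decidable P) (c : ℕ)
                    (P-count : ∑ X (λ x → 𝟙 (does (P? x))) ≤ c)
                    (h : ℕ → ℕ → ℕ) where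

    layer rest : List A → List A
    layer = filter P?
    rest  = filter (∁? P?)

    -- F, with u letters already in the layer and l letters still free,
    -- has total weight at most h (a + |u|) (b + l).
    Bounded : (m a b : ℕ) → (List A → List A → ℕ) → Set
    Bounded m a b F = ∀ u l → length u + l ≡ m → ∑ʷ l (F u) ≤ h (a + length u) (b + l)

    split-bound : ∀ m a b (F : List A → List A → ℕ) → Bounded m a b F →
                  ∑ʷ m (λ zs → F (layer zs) (rest zs)) ≤ layerBound c h a b m
    split-bound zero a b F bounded =
      subst₂ (λ i j → F [] [] ≤ h i j) (+-identityʳ a) (+-identityʳ b) (bounded [] 0 refl)
    split-bound (suc m) a b F bounded = begin
      ∑ X (λ x → ∑ʷ m (λ zs → F (layer (x ∷ zs)) (rest (x ∷ zs))))
        ≤⟨ ∑-mono X first-letter ⟩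
      ∑ X (λ x → 𝟙 (does (P? x)) * layerBound c h (suc a) b m + ∑ʷ m (λ zs → F (layer zs) (x ∷ rest zs)))
        ≡⟨ ∑-+ X _ _ ⟩
      ∑ X (λ x → 𝟙 (does (P? x)) * layerBound c h (suc a) b m) + ∑ X (λ x → ∑ʷ m (λ zs → F (layer zs) (x ∷ rest zs)))
        ≡⟨ cong₂ _+_ (∑-*ʳ X _ (λ x → 𝟙 (does (P? x)))) (sym (∑ʷ-swap X m (λ x zs → F (layer zs) (x ∷ rest zs)))) ⟩
      ∑ X (λ x → 𝟙 (does (P? x))) * layerBound c h (suc a) b m + ∑ʷ m (λ zs → F′ (layer zs) (rest zs))
        ≤⟨ +-mono-≤ (*-monoˡ-≤ _ P-count) (split-bound m a (suc b) F′ bounded′) ⟩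
      c * layerBound c h (suc a) b m + layerBound c h a (suc b) m ∎
      where
      open ≤-Reasoning
      -- a deferred first letter is forgotten: sum over all its values
      F′ : List A → List A → ℕ
      F′ u w = ∑ X (λ x → F u (x ∷ w))
      bounded′ : Bounded m a (suc b) F′
      bounded′ u l |u|+l≡m = begin
        ∑ʷ l (F′ u)                 ≡⟨ ∑ʷ-swap X l (λ x w → F u (x ∷ w)) ⟩
        ∑ʷ (suc l) (F u)            ≤⟨ bounded u (suc l) (trans (+-suc (length u) l) (cong suc |u|+l≡m)) ⟩
        h (a + length u) (b + suc l) ≡⟨ cong (h (a + length u)) (+-suc b l) ⟩
        h (a + length u) (suc b + l) ∎
      -- the first letter either starts the layer or is deferred
      first-letter : ∀ x → ∑ʷ m (λ zs → F (layer (x ∷ zs)) (rest (x ∷ zs))) ≤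
                     𝟙 (does (P? x)) * layerBound c h (suc a) b m + ∑ʷ m (λ zs → F (layer zs) (x ∷ rest zs))
      first-letter x with does (P? x)
      ... | true  = ≤-trans (split-bound m (suc a) b (λ u → F (x ∷ u)) bounded-x)
                            (≤-trans (m≤m+n _ 0) (m≤m+n _ _))
        where
        bounded-x : Bounded m (suc a) b (λ u → F (x ∷ u))
        bounded-x u l |u|+l≡m =
          subst (λ i → ∑ʷ l (F (x ∷ u)) ≤ h i (b + l)) (+-suc a (length u))
                (bounded (x ∷ u) l (cong suc |u|+l≡m))
      ... | false = ≤-refl

-- forests c l = c (c+l)^(l-1) (and 1 for l = 0) is the number of forests on
-- c + l labelled vertices whose roots are c prescribed vertices.
forests : ℕ → ℕ → ℕ
forests c zero    = 1
forests c (suc l) = c * (c + suc l) ^ l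

-- cleared of the division by c + l
forests-closed : ∀ c l → (c + l) * forests c l ≡ c * (c + l) ^ l
forests-closed c zero    = trans (*-identityʳ (c + 0)) (trans (+-identityʳ c) (sym (*-identityʳ c)))
forests-closed c (suc l) = rearrange (c + suc l) c ((c + suc l) ^ l)
  where
  rearrange : ∀ n c p → n * (c * p) ≡ c * (n * p)
  rearrange = solve-∀

-- dpow N m = m N^(m-1), the derivative of N^m with respect to N.
dpow : ℕ → ℕ → ℕ
dpow N zero    = 0
dpow N (suc m) = N ^ m + N * dpow N m

dpow-closed : ∀ N m → dpow N (suc m) ≡ suc m * N ^ m
dpow-closed N zero    = cong (1 +_) (*-zeroʳ N)
dpow-closed N (suc m) = trans (cong (λ t → N * N ^ m + N * t) (dpow-closed N m)) (rearrange N (N ^ m) m)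
  where
  rearrange : ∀ N p m → N * p + N * (p + m * p) ≡ N * p + (N * p + m * (N * p))
  rearrange = solve-∀

-- The closed form of n · layerBound, for n = a + b + m and k roots.
abelForm : (k n a b m : ℕ) → ℕ
abelForm k n a b m = n ^ b * (a * (k + n) ^ m + k * dpow (k + n) m)

abelForm-step : ∀ k n a b m →
                abelForm k n a b (suc m) ≡ k * abelForm k n (suc a) b m + abelForm k n a (suc b) m
abelForm-step k n a b m = expand k n a (n ^ b) ((k + n) ^ m) (dpow (k + n) m)
  where
  expand : ∀ k n a nb Nm d →
    nb * (a * ((k + n) * Nm) + k * (Nm + (k + n) * d)) ≡
    k * (nb * (suc a * Nm + k * d)) + n * nb * (a * Nm + k * d)
  expand = solve-∀

-- layerBound for k roots, at most k·I choices per letter of a layer, and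
-- the forest weights: Abel's identity evaluates it in closed form.
module Abel (k I : ℕ) where

  weight : ℕ → ℕ → ℕ
  weight j l = forests j l * I ^ l

  bound : ℕ → ℕ → ℕ → ℕ
  bound = layerBound (k * I) weight

  bound-closed : ∀ m a b → (a + b + m) * bound a b m ≡ I ^ (b + m) * abelForm k (a + b + m) a b m
  bound-closed zero a b rewrite +-identityʳ (a + b) | +-identityʳ b = begin
    (a + b) * (forests a b * I ^ b)  ≡⟨ sym (*-assoc (a + b) _ _) ⟩
    (a + b) * forests a b * I ^ b    ≡⟨ cong (_* I ^ b) (forests-closed a b) ⟩
    a * (a + b) ^ b * I ^ b          ≡⟨ rearrange a ((a + b) ^ b) (I ^ b) k ⟩
    I ^ b * abelForm k (a + b) a b 0 ∎
    where
    open ≡-Reasoning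
    rearrange : ∀ a p i k → a * p * i ≡ i * (p * (a * 1 + k * 0))
    rearrange = solve-∀
  bound-closed (suc m) a b = begin
    n * (k * I * bound (suc a) b m + bound a (suc b) m)
      ≡⟨ distribute n k I (bound (suc a) b m) (bound a (suc b) m) ⟩
    I * (k * (n * bound (suc a) b m)) + n * bound a (suc b) m
      ≡⟨ cong₂ (λ u v → I * (k * u) + v) shift-a shift-b ⟩
    I * (k * (I ^ (b + m) * abelForm k n (suc a) b m)) + I * I ^ (b + m) * abelForm k n a (suc b) m
      ≡⟨ collect k I (I ^ (b + m)) (abelForm k n (suc a) b m) (abelForm k n a (suc b) m) ⟩
    I ^ suc (b + m) * (k * abelForm k n (suc a) b m + abelForm k n a (suc b) m)
      ≡⟨ cong₂ _*_ (cong (I ^_) (sym (+-suc b m))) (sym (abelForm-step k n a b m)) ⟩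
    I ^ (b + suc m) * abelForm k n a b (suc m) ∎
    where
    open ≡-Reasoning
    n = a + b + suc m
    distribute : ∀ n k I B₁ B₂ → n * (k * I * B₁ + B₂) ≡ I * (k * (n * B₁)) + n * B₂
    distribute = solve-∀
    collect : ∀ k I p Φ₁ Φ₂ → I * (k * (p * Φ₁)) + I * p * Φ₂ ≡ I * p * (k * Φ₁ + Φ₂)
    collect = solve-∀
    moved-a : ∀ a b m → suc a + b + m ≡ a + b + suc m
    moved-a = solve-∀
    moved-b : ∀ a b m → a + suc b + m ≡ a + b + suc m
    moved-b = solve-∀
    shift-a : n * bound (suc a) b m ≡ I ^ (b + m) * abelForm k n (suc a) b m
    shift-a = subst (λ t → t * bound (suc a) b m ≡ I ^ (b + m) * abelForm k t (suc a) b m)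
                    (moved-a a b m) (bound-closed m (suc a) b)
    shift-b : n * bound a (suc b) m ≡ I * I ^ (b + m) * abelForm k n a (suc b) m
    shift-b = subst (λ t → t * bound a (suc b) m ≡ I * I ^ (b + m) * abelForm k t a (suc b) m)
                    (moved-b a b m) (bound-closed m a (suc b))

  bound-forests : ∀ m → bound 0 0 m ≡ forests k m * I ^ m
  bound-forests zero    = refl
  bound-forests (suc j) = *-cancelˡ-≡ _ _ (suc j) (begin
    suc j * bound 0 0 (suc j)                          ≡⟨ bound-closed (suc j) 0 0 ⟩
    I ^ suc j * abelForm k (suc j) 0 0 (suc j)         ≡⟨ cong (λ t → I ^ suc j * (1 * (0 * N ^ suc j + k * t))) (dpow-closed N j) ⟩
    I ^ suc j * (1 * (0 * N ^ suc j + k * (suc j * N ^ j)))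
                                                       ≡⟨ rearrange (I ^ suc j) k (suc j) (N ^ j) (N ^ suc j) ⟩
    suc j * (forests k (suc j) * I ^ suc j)            ∎)
    where
    open ≡-Reasoning
    N = k + suc j
    rearrange : ∀ i k s p q → i * (1 * (0 * q + k * (s * p))) ≡ s * (k * p * i)
    rearrange = solve-∀

-- Letters are vertices, rel is adjacency, and every letter is adjacent to at
-- most I letters of X.
module Layers {A : Set} (X : List A) (rel : A → A → Bool) (I : ℕ)
              (rel-count : ∀ y → ∑ X (λ x → 𝟙 (rel x y)) ≤ I) where

  open Words X

  Near : List A → Pred A 0ℓ
  Near ys x = T (any (rel x) ys)

  near? : ∀ ys → Decidable (Near ys)
  near? ys x = T? (any (rel x) ys)

  near-intro : ∀ {x y ys} → y ∈ ys → T (rel x y) → Near ys x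
  near-intro {x} y∈ys xy = any⁺ (rel x) (lose y∈ys xy)

  -- union bound: at most |ys| · I letters are near ys
  near-count : ∀ ys → ∑ X (λ x → 𝟙 (does (near? ys x))) ≤ length ys * I
  near-count []       = ≤-reflexive (∑-zero X)
  near-count (y ∷ ys) = begin
    ∑ X (λ x → 𝟙 (rel x y ∨ any (rel x) ys))          ≤⟨ ∑-mono X (λ x → 𝟙-∨ (rel x y) _) ⟩
    ∑ X (λ x → 𝟙 (rel x y) + 𝟙 (any (rel x) ys))      ≡⟨ ∑-+ X _ _ ⟩
    ∑ X (λ x → 𝟙 (rel x y)) + ∑ X (λ x → 𝟙 (any (rel x) ys))
                                                       ≤⟨ +-mono-≤ (rel-count y) (near-count ys) ⟩
    I + length ys * I                                  ∎
    where open ≤-Reasoning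

  near far : List A → List A → List A
  near ys = filter (near? ys)
  far  ys = filter (∁? (near? ys))

  -- reach f ys zs is 1 if breadth-first search from the layer ys exhausts zs
  -- within f further layers and 0 otherwise; the search fails as soon as a
  -- layer is empty.
  reach    : ℕ → List A → List A → ℕ
  continue : ℕ → List A → List A → ℕ
  reach f       ys []             = 1
  reach zero    ys (z ∷ zs)       = 0
  reach (suc f) ys zs@(_ ∷ _)     = continue f (near ys zs) (far ys zs)
  continue f []       zs = 0
  continue f (y ∷ ys) zs = reach f (y ∷ ys) zs

  data Linked (ys zs : List A) : A → Set where
    adjacent : ∀ {x y} → y ∈ ys → T (rel x y) → Linked ys zs x
    via      : ∀ {x z} → z ∈ zs → T (rel x z) → Linked ys zs z → Linked ys zs x

  AllLinked : List A → List A → Set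
  AllLinked ys zs = ∀ {x} → x ∈ zs → Linked ys zs x

  linked-near : ∀ {ys zs x} → Linked ys zs x → x ∈ zs → ∃ λ z → z ∈ zs × Near ys z
  linked-near (adjacent y∈ys xy) x∈zs = _ , x∈zs , near-intro y∈ys xy
  linked-near (via z∈zs xz linked) _  = linked-near linked z∈zs

  linked-far : ∀ {ys zs x} → ¬ Near ys x → Linked ys zs x → Linked (near ys zs) (far ys zs) x
  linked-far ¬near (adjacent y∈ys xy) = ⊥-elim (¬near (near-intro y∈ys xy))
  linked-far {ys} ¬near (via {z = z} z∈zs xz linked) with near? ys z
  ... | yes near-z  = adjacent (∈-filter⁺ (near? ys) z∈zs near-z) xz
  ... | no  ¬near-z = via (∈-filter⁺ (∁? (near? ys)) z∈zs ¬near-z) xz (linked-far ¬near-z linked)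

  all-linked-far : ∀ {ys zs} → AllLinked ys zs → AllLinked (near ys zs) (far ys zs)
  all-linked-far {ys} {zs} all-linked x∈far with ∈-filter⁻ (∁? (near? ys)) {xs = zs} x∈far
  ... | x∈zs , ¬near = linked-far ¬near (all-linked x∈zs)

  reach-complete : ∀ f ys zs → length zs ≤ f → AllLinked ys zs → 1 ≤ reach f ys zs
  reach-complete f       ys []            _     _          = ≤-refl
  reach-complete (suc f) ys zs@(_ ∷ _) |zs|≤ all-linked with linked-near (all-linked (here refl)) (here refl)
  ... | w , w∈zs , near-w =
    continue-complete (near ys zs) (far ys zs) (∈-filter⁺ (near? ys) w∈zs near-w)
      (≤-trans (≤-reflexive (filter-partition (near? ys) zs)) |zs|≤) (all-linked-far all-linked)
    where
    continue-complete : ∀ J R → w ∈ J → length J + length R ≤ suc f → AllLinked J R → 1 ≤ continue f J R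
    continue-complete []      R ()
    continue-complete (j ∷ J) R _ (s≤s |J|+|R|≤f) =
      reach-complete f (j ∷ J) R (≤-trans (m≤n+m _ _) |J|+|R|≤f)

  reach-count : ∀ f m → m ≤ f → ∀ ys → ∑ʷ m (reach f ys) ≤ forests (length ys) m * I ^ m
  reach-count f       zero    _         ys = ≤-refl
  reach-count (suc f) (suc m) (s≤s m≤f) ys = begin
    ∑ʷ (suc m) (reach (suc f) ys)                    ≤⟨ split-bound (suc m) 0 0 (continue f) bounded ⟩
    layerBound (length ys * I) weight 0 0 (suc m)    ≡⟨ bound-forests (suc m) ⟩
    forests (length ys) (suc m) * I ^ suc m          ∎
    where
    open ≤-Reasoning
    open Abel (length ys) I
    open LayerSplit (near? ys) (length ys * I) (near-count ys) weight
    bounded : Bounded (suc m) 0 0 (continue f)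
    bounded []      l _        = ≤-trans (≤-reflexive (∑ʷ-zero l)) z≤n
    bounded (x ∷ u) l |xu|+l≡ =
      reach-count f l (≤-trans (m≤n+m l (length u)) (≤-trans (≤-reflexive (suc-injective |xu|+l≡)) m≤f)) (x ∷ u)

meets : ∀ {n} → Subset n → Subset n → Bool
meets []      []      = false
meets (a ∷ s) (b ∷ t) = (a ∧ b) ∨ meets s t

meets-sym : ∀ {n} (s t : Subset n) → meets s t ≡ meets t s
meets-sym []      []      = refl
meets-sym (a ∷ s) (b ∷ t) = cong₂ _∨_ (∧-comm a b) (meets-sym s t)

meets-at : ∀ {n} (s t : Subset n) i → T (lookup s i ∧ lookup t i) → T (meets s t)
meets-at (a ∷ s) (b ∷ t) zero    st = Equivalence.from T-∨ (inj₁ st)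
meets-at (a ∷ s) (b ∷ t) (suc i) st = Equivalence.from T-∨ (inj₂ (meets-at s t i st))

meets-nonempty : ∀ {n} (s t : Subset n) → Nonempty (s ∩ t) → T (meets s t)
meets-nonempty s t (i , i∈s∩t) =
  meets-at s t i (Equivalence.from T-≡ (trans (sym (lookup-zipWith _∧_ i s t)) ([]=⇒lookup i∈s∩t)))

withKey : ∀ {K P} → KeyRing K P → KeyRing (suc K) (suc P)
withKey (s , |s|≡K) = true ∷ s , cong suc |s|≡K

withoutKey : ∀ {K P} → KeyRing K P → KeyRing K (suc P)
withoutKey (s , |s|≡K) = false ∷ s , |s|≡K

-- key rings are determined by their subsets (the size proof is irrelevant)
keyRing-≡ : ∀ {K P} {x y : KeyRing K P} → proj₁ x ≡ proj₁ y → x ≡ y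
keyRing-≡ {x = s , e} {y = .s , e′} refl = cong (s ,_) (≡-irrelevant e e′)

withKey-injective : ∀ {K P} {x y : KeyRing K P} → withKey x ≡ withKey y → x ≡ y
withKey-injective eq = keyRing-≡ (proj₂ (∷-injective (cong proj₁ eq)))

withoutKey-injective : ∀ {K P} {x y : KeyRing K P} → withoutKey x ≡ withoutKey y → x ≡ y
withoutKey-injective eq = keyRing-≡ (proj₂ (∷-injective (cong proj₁ eq)))

keyRings : ∀ P K → List (KeyRing K P)
keyRings zero    zero    = ([] , refl) ∷ []
keyRings zero    (suc K) = []
keyRings (suc P) zero    = map withoutKey (keyRings P zero)
keyRings (suc P) (suc K) = map withKey (keyRings P K) ++ map withoutKey (keyRings P (suc K))

keyRings-length : ∀ P K → length (keyRings P K) ≡ P C K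
keyRings-length zero    zero    = refl
keyRings-length zero    (suc K) = refl
keyRings-length (suc P) zero    = trans (length-map withoutKey (keyRings P zero)) (keyRings-length P zero)
keyRings-length (suc P) (suc K) = begin
  length (map withKey (keyRings P K) ++ map withoutKey (keyRings P (suc K)))
    ≡⟨ length-++ (map withKey (keyRings P K)) ⟩
  length (map withKey (keyRings P K)) + length (map withoutKey (keyRings P (suc K)))
    ≡⟨ cong₂ _+_ (trans (length-map withKey (keyRings P K)) (keyRings-length P K))
                 (trans (length-map withoutKey (keyRings P (suc K))) (keyRings-length P (suc K))) ⟩
  P C K + P C suc K
    ≡⟨ nCk+nC[k+1]≡[n+1]C[k+1] P K ⟩
  suc P C suc K ∎
  where open ≡-Reasoning

keyRings-unique : ∀ P K → Unique (keyRings P K)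
keyRings-unique zero    zero    = [] ∷ []
keyRings-unique zero    (suc K) = []
keyRings-unique (suc P) zero    = Uniqueₚ.map⁺ withoutKey-injective (keyRings-unique P zero)
keyRings-unique (suc P) (suc K) =
  Uniqueₚ.++⁺ (Uniqueₚ.map⁺ withKey-injective (keyRings-unique P K))
              (Uniqueₚ.map⁺ withoutKey-injective (keyRings-unique P (suc K))) first-key-differs
  where
  first-key-differs : ∀ {v} → v ∈ map withKey (keyRings P K) × v ∈ map withoutKey (keyRings P (suc K)) → ⊥
  first-key-differs (v∈₁ , v∈₂) with ∈-map⁻ withKey v∈₁ | ∈-map⁻ withoutKey v∈₂
  ... | x , _ , refl | y , _ , eq with cong (head ∘ proj₁) eq
  ...   | ()

keyRings-complete : ∀ P K (x : KeyRing K P) → x ∈ keyRings P K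
keyRings-complete zero    zero    ([] , refl)      = here refl
keyRings-complete zero    (suc K) ([] , ())
keyRings-complete (suc P) zero    (true ∷ s , ())
keyRings-complete (suc P) zero    (false ∷ s , e)  = ∈-map⁺ withoutKey (keyRings-complete P zero (s , e))
keyRings-complete (suc P) (suc K) (true ∷ s , e)   =
  ∈-++⁺ˡ (subst (_∈ map withKey (keyRings P K)) (keyRing-≡ refl)
                (∈-map⁺ withKey (keyRings-complete P K (s , suc-injective e))))
keyRings-complete (suc P) (suc K) (false ∷ s , e)  =
  ∈-++⁺ʳ (map withKey (keyRings P K)) (∈-map⁺ withoutKey (keyRings-complete P (suc K) (s , e)))

disjoint-count : ∀ P K (s : Subset P) → ∑ (keyRings P K) (λ x → 𝟙 (not (meets s (proj₁ x)))) ≡ (P ∸ ∣ s ∣) C K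
disjoint-count zero    zero    []      = refl
disjoint-count zero    (suc K) []      = refl
disjoint-count (suc P) zero    (b ∷ s) = begin
  ∑ (map withoutKey (keyRings P zero)) avoids                     ≡⟨ ∑-map withoutKey (keyRings P zero) avoids ⟩
  ∑ (keyRings P zero) (λ x → 𝟙 (not (b ∧ false ∨ meets s (proj₁ x))))
    ≡⟨ ∑-cong (keyRings P zero) (λ x → cong (λ c → 𝟙 (not (c ∨ meets s (proj₁ x)))) (∧-zeroʳ b)) ⟩
  ∑ (keyRings P zero) (λ x → 𝟙 (not (meets s (proj₁ x))))         ≡⟨ disjoint-count P zero s ⟩
  1 ∎
  where
  open ≡-Reasoning
  avoids : KeyRing zero (suc P) → ℕ
  avoids x = 𝟙 (not (meets (b ∷ s) (proj₁ x)))
disjoint-count (suc P) (suc K) (true ∷ s) = begin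
  ∑ (map withKey (keyRings P K) ++ map withoutKey (keyRings P (suc K))) avoids
    ≡⟨ ∑-++ (map withKey (keyRings P K)) _ avoids ⟩
  ∑ (map withKey (keyRings P K)) avoids + ∑ (map withoutKey (keyRings P (suc K))) avoids
    ≡⟨ cong₂ _+_ (trans (∑-map withKey (keyRings P K) avoids) (∑-zero (keyRings P K)))
                 (trans (∑-map withoutKey (keyRings P (suc K)) avoids) (disjoint-count P (suc K) s)) ⟩
  (P ∸ ∣ s ∣) C suc K ∎
  where
  open ≡-Reasoning
  avoids : KeyRing (suc K) (suc P) → ℕ
  avoids x = 𝟙 (not (meets (true ∷ s) (proj₁ x)))
disjoint-count (suc P) (suc K) (false ∷ s) = begin
  ∑ (map withKey (keyRings P K) ++ map withoutKey (keyRings P (suc K))) avoids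
    ≡⟨ ∑-++ (map withKey (keyRings P K)) _ avoids ⟩
  ∑ (map withKey (keyRings P K)) avoids + ∑ (map withoutKey (keyRings P (suc K))) avoids
    ≡⟨ cong₂ _+_ (trans (∑-map withKey (keyRings P K) avoids) (disjoint-count P K s))
                 (trans (∑-map withoutKey (keyRings P (suc K)) avoids) (disjoint-count P (suc K) s)) ⟩
  (P ∸ ∣ s ∣) C K + (P ∸ ∣ s ∣) C suc K ≡⟨ nCk+nC[k+1]≡[n+1]C[k+1] (P ∸ ∣ s ∣) K ⟩
  suc (P ∸ ∣ s ∣) C suc K               ≡⟨ cong (_C suc K) (sym (+-∸-assoc 1 (∣p∣≤n s))) ⟩
  (suc P ∸ ∣ s ∣) C suc K ∎
  where
  open ≡-Reasoning
  avoids : KeyRing (suc K) (suc P) → ℕ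
  avoids x = 𝟙 (not (meets (false ∷ s) (proj₁ x)))

someKeyRing : ∀ P K → K ≤ P → KeyRing K P
someKeyRing zero    zero    _         = [] , refl
someKeyRing (suc P) zero    _         = withoutKey (someKeyRing P zero z≤n)
someKeyRing (suc P) (suc K) (s≤s K≤P) = withKey (someKeyRing P K K≤P)

toℚᵘ-frac : ∀ a d → toℚᵘ (frac a (suc d)) ℚᵘ.≃ mkℚᵘ (ℤ.+ a) d
toℚᵘ-frac a d = toℚᵘ-fromℚᵘ (mkℚᵘ (ℤ.+ a) d)

frac-≤ : ∀ a b c d → 1 ≤ b → 1 ≤ d → a * d ≤ c * b → frac a b Q.≤ frac c d
frac-≤ a (suc b) c (suc d) _ _ ad≤cb =
  toℚᵘ-cancel-≤ (ℚᵘP.≤-respʳ-≃ (ℚᵘP.≃-sym (toℚᵘ-frac c d))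
                  (ℚᵘP.≤-respˡ-≃ (ℚᵘP.≃-sym (toℚᵘ-frac a b))
                    (*≤* (subst₂ ℤ._≤_ (ℤP.pos-* a (suc d)) (ℤP.pos-* c (suc b)) (ℤ.+≤+ ad≤cb)))))

frac-* : ∀ a b c d → 1 ≤ b → 1 ≤ d → frac a b Q.* frac c d ≡ frac (a * c) (b * d)
frac-* a (suc b) c (suc d) _ _ = toℚᵘ-injective (begin
  toℚᵘ (frac a (suc b) Q.* frac c (suc d))             ≈⟨ toℚᵘ-homo-* (frac a (suc b)) (frac c (suc d)) ⟩
  toℚᵘ (frac a (suc b)) ℚᵘ.* toℚᵘ (frac c (suc d))     ≈⟨ ℚᵘP.*-cong (toℚᵘ-frac a b) (toℚᵘ-frac c d) ⟩
  mkℚᵘ (ℤ.+ a ℤ.* ℤ.+ c) _                             ≡⟨ cong (λ z → mkℚᵘ z _) (sym (ℤP.pos-* a c)) ⟩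
  mkℚᵘ (ℤ.+ (a * c)) _                                  ≈⟨ ℚᵘP.≃-sym (toℚᵘ-frac (a * c) _) ⟩
  toℚᵘ (frac (a * c) (suc b * suc d))                   ∎)
  where open ℚᵘP.≃-Reasoning

frac-^ : ∀ c M e → 1 ≤ M → frac c M ^ℚ e ≡ frac (c ^ e) (M ^ e)
frac-^ c M zero    _   = refl
frac-^ c M (suc e) 1≤M = trans (cong (frac c M Q.*_) (frac-^ c M e 1≤M))
                               (frac-* c M (c ^ e) (M ^ e) 1≤M (m^n>0 M {{>-nonZero 1≤M}} e))

1-frac : ∀ D M → 1 ≤ M → D ≤ M → 1ℚ - frac D M ≡ frac (M ∸ D) M
1-frac D (suc m) _ D≤M = toℚᵘ-injective (begin
  toℚᵘ (1ℚ Q.+ Q.- frac D (suc m))            ≈⟨ toℚᵘ-homo-+ 1ℚ (Q.- frac D (suc m)) ⟩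
  toℚᵘ 1ℚ ℚᵘ.+ toℚᵘ (Q.- frac D (suc m))      ≈⟨ ℚᵘP.+-congʳ (toℚᵘ 1ℚ) (ℚᵘP.≃-trans (toℚᵘ-homo‿- (frac D (suc m))) (ℚᵘP.-‿cong (toℚᵘ-frac D m))) ⟩
  toℚᵘ 1ℚ ℚᵘ.+ ℚᵘ.- mkℚᵘ (ℤ.+ D) m            ≈⟨ *≡* cross ⟩
  mkℚᵘ (ℤ.+ (suc m ∸ D)) m                     ≈⟨ ℚᵘP.≃-sym (toℚᵘ-frac (suc m ∸ D) m) ⟩
  toℚᵘ (frac (suc m ∸ D) (suc m))              ∎)
  where
  open ℚᵘP.≃-Reasoning
  difference : ℤ.+ (suc m ∸ D) ≡ ℤ.+ suc m ℤ.+ ℤ.- ℤ.+ D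
  difference = trans (sym (ℤP.⊖-≥ D≤M)) (sym (ℤP.m-n≡m⊖n (suc m) D))
  rearrange : ∀ s d → (ℤ.+ 1 ℤ.* s ℤ.+ ℤ.- d ℤ.* ℤ.+ 1) ℤ.* s ≡ (s ℤ.+ ℤ.- d) ℤ.* (ℤ.+ 1 ℤ.* s)
  rearrange = ℤSolver.solve-∀
  cross : (ℤ.+ 1 ℤ.* ℤ.+ suc m ℤ.+ ℤ.- ℤ.+ D ℤ.* ℤ.+ 1) ℤ.* ℤ.+ suc m ≡ ℤ.+ (suc m ∸ D) ℤ.* ℤ.+ (1 * suc m)
  cross = trans (rearrange (ℤ.+ suc m) (ℤ.+ D)) (cong₂ ℤ._*_ (sym difference) (sym (ℤP.pos-* 1 (suc m))))

prefix : ∀ {A : Set} {n} → ℕ → Vec A n → List A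
prefix zero    v       = []
prefix (suc k) []      = []
prefix (suc k) (x ∷ v) = x ∷ prefix k v

prefix-length : ∀ {A : Set} {n} k (v : Vec A n) → length (prefix k v) ≤ k
prefix-length zero    v       = z≤n
prefix-length (suc k) []      = z≤n
prefix-length (suc k) (x ∷ v) = s≤s (prefix-length k v)

∈-prefix⁺ : ∀ {A : Set} {k n} (i : Fin k) (k≤n : k ≤ n) (v : Vec A n) → lookup v (inject≤ i k≤n) ∈ prefix k v
∈-prefix⁺ {n = suc n} zero    k≤n (x ∷ v) = here refl
∈-prefix⁺ {n = suc n} (suc i) k≤n (x ∷ v) = there (∈-prefix⁺ i (≤-pred k≤n) v)

∈-prefix⁻ : ∀ {A : Set} {k n} {z : A} (k≤n : k ≤ n) (v : Vec A n) → z ∈ prefix k v →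
            ∃ λ (i : Fin k) → z ≡ lookup v (inject≤ i k≤n)
∈-prefix⁻ {k = suc k} {suc n} k≤n (x ∷ v) (here refl) = zero , refl
∈-prefix⁻ {k = suc k} {suc n} k≤n (x ∷ v) (there z∈) with ∈-prefix⁻ (≤-pred k≤n) v z∈
... | i , refl = suc i , refl

forests-one : ∀ m → forests 1 m ≡ suc m ^ (m ∸ 1)
forests-one zero    = refl
forests-one (suc m) = +-identityʳ _

module Counting (K P : ℕ) (K≤P : K ≤ P) where

  M D I : ℕ
  M = P C K
  D = (P ∸ K) C K
  I = M ∸ D

  X : List (KeyRing K P)
  X = keyRings P K

  rel : KeyRing K P → KeyRing K P → Bool
  rel x y = meets (proj₁ x) (proj₁ y)

  meeting+avoiding : ∀ y → ∑ X (λ x → 𝟙 (rel x y)) + D ≡ M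
  meeting+avoiding (t , |t|≡K) = begin
    ∑ X (λ x → 𝟙 (rel x y)) + D
      ≡⟨ cong (∑ X (λ x → 𝟙 (rel x y)) +_) (sym avoiding) ⟩
    ∑ X (λ x → 𝟙 (rel x y)) + ∑ X (λ x → 𝟙 (not (rel x y)))
      ≡⟨ ∑-𝟙-split X (λ x → rel x y) ⟩
    length X ≡⟨ keyRings-length P K ⟩
    M ∎
    where
    open ≡-Reasoning
    y = t , |t|≡K
    avoiding : ∑ X (λ x → 𝟙 (not (rel x y))) ≡ D
    avoiding = trans (∑-cong X (λ x → cong (𝟙 ∘ not) (meets-sym (proj₁ x) t)))
                     (trans (disjoint-count P K t) (cong (λ k → (P ∸ k) C K) |t|≡K))

  rel-count : ∀ y → ∑ X (λ x → 𝟙 (rel x y)) ≤ I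
  rel-count y = ≤-reflexive (trans (sym (m+n∸n≡m _ D)) (cong (_∸ D) (meeting+avoiding y)))

  D≤M : D ≤ M
  D≤M = ≤-trans (m≤n+m D _) (≤-reflexive (meeting+avoiding (someKeyRing P K K≤P)))

  1≤M : 1 ≤ M
  1≤M = ≤-trans (∈-length (keyRings-complete P K (someKeyRing P K K≤P))) (≤-reflexive (keyRings-length P K))

  open Words X
  open Layers X rel I rel-count

  outcomes : ∀ n → List (Outcome n K P)
  outcomes zero    = [] ∷ []
  outcomes (suc n) = cartesianProductWith _∷_ X (outcomes n)

  outcomes-length : ∀ n → length (outcomes n) ≡ M ^ n
  outcomes-length zero    = refl
  outcomes-length (suc n) =
    trans (length-cartesian _∷_ X (outcomes n)) (cong₂ _*_ (keyRings-length P K) (outcomes-length n))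

  outcomes-unique : ∀ n → Unique (outcomes n)
  outcomes-unique zero    = [] ∷ []
  outcomes-unique (suc n) = Uniqueₚ.cartesianProductWith⁺ _∷_ ∷-injective (keyRings-unique P K) (outcomes-unique n)

  outcomes-complete : ∀ n (ω : Outcome n K P) → ω ∈ outcomes n
  outcomes-complete zero    []      = here refl
  outcomes-complete (suc n) (x ∷ ω) = ∈-cartesianProductWith⁺ _∷_ (keyRings-complete P K x) (outcomes-complete n ω)

  enumeration-size : ∀ n (xs : List (Outcome n K P)) → Enumerates xs → M ^ n ≤ length xs
  enumeration-size n xs (_ , complete) =
    ≤-trans (≤-reflexive (sym (outcomes-length n))) (unique-length-≤ (outcomes-unique n) (λ {ω} _ → complete ω))

  -- a function of the first k key rings is summed over the other n - k freely
  ∑-prefix : ∀ k n → k ≤ n → (g : List (KeyRing K P) → ℕ) →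
             ∑ (outcomes n) (g ∘ prefix k) ≡ M ^ (n ∸ k) * ∑ʷ k g
  ∑-prefix zero    n       _         g = trans (∑-const (outcomes n) (g [])) (cong (_* g []) (outcomes-length n))
  ∑-prefix (suc k) (suc n) (s≤s k≤n) g = begin
    ∑ (outcomes (suc n)) (g ∘ prefix (suc k))
      ≡⟨ ∑-cartesian _∷_ X (outcomes n) _ ⟩
    ∑ X (λ x → ∑ (outcomes n) (λ ω → g (x ∷ prefix k ω)))
      ≡⟨ ∑-cong X (λ x → ∑-prefix k n k≤n (λ zs → g (x ∷ zs))) ⟩
    ∑ X (λ x → M ^ (n ∸ k) * ∑ʷ k (λ zs → g (x ∷ zs)))
      ≡⟨ ∑-*ˡ X (M ^ (n ∸ k)) (λ x → ∑ʷ k (λ zs → g (x ∷ zs))) ⟩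
    M ^ (n ∸ k) * ∑ʷ (suc k) g ∎
    where open ≡-Reasoning

  connected⇒reach : ∀ {n r} (r≤n : suc r ≤ suc n) (x : KeyRing K P) (ω : Vec (KeyRing K P) n) →
                    InducedConnected (suc r) r≤n (x ∷ ω) → 1 ≤ reach r (x ∷ []) (prefix r ω)
  connected⇒reach {n} {r} r≤n x ω connected =
    reach-complete r (x ∷ []) (prefix r ω) (prefix-length r ω) all-linked
    where
    key : Fin (suc r) → KeyRing K P
    key a = lookup (x ∷ ω) (inject≤ a r≤n)
    path-linked : ∀ {a} → Star (λ a b → Adj (x ∷ ω) (inject≤ a r≤n) (inject≤ b r≤n)) a zero →
                  a ≢ zero → Linked (x ∷ []) (prefix r ω) (key a)
    path-linked ε                        a≢0 = ⊥-elim (a≢0 refl)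
    path-linked (_◅_ {j = zero}  ab _)   _   = adjacent (here refl) (meets-nonempty _ _ (proj₂ ab))
    path-linked (_◅_ {j = suc b} ab bc)  _   =
      via (∈-prefix⁺ b (≤-pred r≤n) ω) (meets-nonempty _ _ (proj₂ ab)) (path-linked bc (λ ()))
    all-linked : AllLinked (x ∷ []) (prefix r ω)
    all-linked z∈ with ∈-prefix⁻ (≤-pred r≤n) ω z∈
    ... | i , refl = path-linked (connected (suc i) zero) (λ ())

  connected-count : ∀ n r (r≤n : suc r ≤ suc n) (dec : Decidable (InducedConnected {suc n} {K} {P} (suc r) r≤n)) →
                    length (filter dec (outcomes (suc n))) ≤ M * (M ^ (n ∸ r) * (forests 1 r * I ^ r))
  connected-count n r r≤n dec = begin
    length (filter dec (outcomes (suc n)))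
      ≤⟨ length-filter≤∑ dec (outcomes (suc n)) certificate certified ⟩
    ∑ (outcomes (suc n)) certificate
      ≡⟨ ∑-cartesian _∷_ X (outcomes n) certificate ⟩
    ∑ X (λ x → ∑ (outcomes n) (reach r (x ∷ []) ∘ prefix r))
      ≡⟨ ∑-cong X (λ x → ∑-prefix r n (≤-pred r≤n) (reach r (x ∷ []))) ⟩
    ∑ X (λ x → M ^ (n ∸ r) * ∑ʷ r (reach r (x ∷ [])))
      ≤⟨ ∑-mono X (λ x → *-monoʳ-≤ (M ^ (n ∸ r)) (reach-count r r ≤-refl (x ∷ []))) ⟩
    ∑ X (λ _ → M ^ (n ∸ r) * (forests 1 r * I ^ r))
      ≡⟨ trans (∑-const X _) (cong (_* (M ^ (n ∸ r) * (forests 1 r * I ^ r))) (keyRings-length P K)) ⟩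
    M * (M ^ (n ∸ r) * (forests 1 r * I ^ r)) ∎
    where
    open ≤-Reasoning
    certificate : Outcome (suc n) K P → ℕ
    certificate (x ∷ ω) = reach r (x ∷ []) (prefix r ω)
    certified : ∀ ω → InducedConnected (suc r) r≤n ω → 1 ≤ certificate ω
    certified (x ∷ ω) = connected⇒reach r≤n x ω

  -- cleared of denominators: #(connected outcomes) · M^r ≤ (r+1)^(r-1) I^r · #outcomes
  connected-fraction : ∀ n r (r≤n : suc r ≤ n) (xs : List (Outcome n K P)) → Enumerates xs →
                       (dec : Decidable (InducedConnected {n} {K} {P} (suc r) r≤n)) →
                       length (filter dec xs) * M ^ r ≤ suc r ^ (r ∸ 1) * I ^ r * length xs
  connected-fraction (suc n) r r≤n xs enumerates@(unique , _) dec = begin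
    length (filter dec xs) * M ^ r
      ≤⟨ *-monoˡ-≤ (M ^ r) (≤-trans in-outcomes (connected-count n r r≤n dec)) ⟩
    M * (M ^ (n ∸ r) * (forests 1 r * I ^ r)) * M ^ r
      ≡⟨ rearrange M (M ^ (n ∸ r)) (forests 1 r) (I ^ r) (M ^ r) ⟩
    forests 1 r * I ^ r * (M * (M ^ (n ∸ r) * M ^ r))
      ≡⟨ cong₂ (λ f p → f * I ^ r * (M * p)) (forests-one r)
               (trans (sym (^-distribˡ-+-* M (n ∸ r) r)) (cong (M ^_) (m∸n+n≡m (≤-pred r≤n)))) ⟩
    suc r ^ (r ∸ 1) * I ^ r * M ^ suc n
      ≤⟨ *-monoʳ-≤ (suc r ^ (r ∸ 1) * I ^ r) (enumeration-size (suc n) xs enumerates) ⟩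
    suc r ^ (r ∸ 1) * I ^ r * length xs ∎
    where
    open ≤-Reasoning
    in-outcomes : length (filter dec xs) ≤ length (filter dec (outcomes (suc n)))
    in-outcomes = unique-length-≤ (Uniqueₚ.filter⁺ dec unique)
      (λ {ω} ω∈ → ∈-filter⁺ dec (outcomes-complete (suc n) ω) (proj₂ (∈-filter⁻ dec {xs = xs} ω∈)))
    rearrange : ∀ M A F J B → M * (A * (F * J)) * B ≡ F * J * (M * (A * B))
    rearrange = solve-∀

lemma7 : (K P n : ℕ) → 1 ≤ K → 1 ≤ P → 2 * K ≤ P → 2 ≤ n →
    (xs : List (Outcome n K P)) → Enumerates xs →
    (r : ℕ) → 2 ≤ r → (r≤n : r ≤ n) →
    (dec : Decidable (InducedConnected {n} {K} {P} r r≤n)) →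
    Prob xs dec Q.≤ frac (r ^ (r ∸ 2)) 1 Q.* ((1ℚ - q K P) ^ℚ (r ∸ 1))
lemma7 K P n _ _ 2K≤P _ xs enumerates (suc r) _ r≤n dec = begin
  frac (length (filter dec xs)) (length xs)
    ≤⟨ frac-≤ _ _ _ _ 1≤|xs| 1≤M^r (connected-fraction n r r≤n xs enumerates dec) ⟩
  frac (suc r ^ (r ∸ 1) * I ^ r) (M ^ r)
    ≡⟨ cong (frac (suc r ^ (r ∸ 1) * I ^ r)) (sym (*-identityˡ (M ^ r))) ⟩
  frac (suc r ^ (r ∸ 1) * I ^ r) (1 * M ^ r)
    ≡⟨ sym (frac-* (suc r ^ (r ∸ 1)) 1 (I ^ r) (M ^ r) ≤-refl 1≤M^r) ⟩
  frac (suc r ^ (r ∸ 1)) 1 Q.* frac (I ^ r) (M ^ r)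
    ≡⟨ cong (frac (suc r ^ (r ∸ 1)) 1 Q.*_) (sym (frac-^ I M r 1≤M)) ⟩
  frac (suc r ^ (r ∸ 1)) 1 Q.* (frac I M ^ℚ r)
    ≡⟨ cong (λ p → frac (suc r ^ (r ∸ 1)) 1 Q.* (p ^ℚ r)) (sym (1-frac D M 1≤M D≤M)) ⟩
  frac (suc r ^ (r ∸ 1)) 1 Q.* ((1ℚ - q K P) ^ℚ r) ∎
  where
  open ℚP.≤-Reasoning
  open Counting K P (≤-trans (m≤m+n K (K + 0)) 2K≤P)
  1≤|xs| : 1 ≤ length xs
  1≤|xs| = ≤-trans (m^n>0 M {{>-nonZero 1≤M}} n) (enumeration-size n xs enumerates)
  1≤M^r : 1 ≤ M ^ r
  1≤M^r = m^n>0 M {{>-nonZero 1≤M}} r
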